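{- Let $\Theta$ be a type-variable context, let $\Theta\vdash\sigma$ be a well-formed FPC type, let $\Theta,\beta\vdash\tau$ be a well-formed FPC type, and let $\rho:\mathcal U^{|\Theta|}$. Then $[\![\Theta\vdash\tau[\sigma/\beta]]\!](\rho)=[\![\Theta,\beta\vdash\tau]\!](\rho,[\![\Theta\vdash\sigma]\!](\rho))$.
   Context: Work in Guarded Dependent Type Theory (GDTT): for the (implicit) clock there is a type former $\triangleright$ ("later") with $\mathrm{next}:A\to\triangleright A$, later application $\circledast:\triangleright(A\to B)\to\triangleright A\to\triangleright B$ with $\mathrm{next}(f)\circledast\mathrm{next}(t)\equiv\mathrm{next}(f\,t)$, a guarded fixed point combinator $\mathrm{fix}:(\triangleright A\to A)\to A$ with $\mathrm{fix}\,f=f(\mathrm{next}(\mathrm{fix}\,f))$, and a universe $\mathcal U$ (codes and their element types are identified) containing a code $\hat\triangleright:\triangleright\mathcal U\to\mathcal U$ with $\hat\triangleright(\mathrm{next}\,A)\equiv\triangleright A$; this allows guarded recursive types to be defined by $\mathrm{fix}$. $=$ is propositional equality; $\triangleright(t=u)\equiv(\mathrm{next}\,t=\mathrm{next}\,u)$. FPC types in a context $\Theta$ of type variables: $\tau::=\alpha\mid1\mid\tau_1\times\tau_2\mid\tau_1+\tau_2\mid\tau_1\to\tau_2\mid\mu\alpha.\tau$ ($\alpha$ bound in $\mu\alpha.\tau$), with $\Theta\vdash\tau$ meaning all free variables of $\tau$ are in $\Theta$. For a small type $A$, $LA$ is the guarded recursive type with $LA\cong A+\triangleright LA$. The interpretation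 $[\![\Theta\vdash\tau]\!]:\mathcal U^{|\Theta|}\to\mathcal U$ is defined by induction on types and guarded recursion: $[\![\alpha]\!](\rho)=\rho(\alpha)$; $[\![1]\!](\rho)=L1$; $[\![\tau_1\times\tau_2]\!](\rho)=[\![\tau_1]\!](\rho)\times[\![\tau_2]\!](\rho)$; $[\![\tau_1+\tau_2]\!](\rho)=L([\![\tau_1]\!](\rho)+[\![\tau_2]\!](\rho))$; $[\![\tau_1\to\tau_2]\!](\rho)=[\![\tau_1]\!](\rho)\to[\![\tau_2]\!](\rho)$; and $[\![\Theta\vdash\mu\alpha.\tau]\!]$ is the fixed point (via $\mathrm{fix}$) of $\lambda X{:}\triangleright(\mathcal U^{|\Theta|}\to\mathcal U).\lambda\rho.\hat\triangleright(\mathrm{next}(\lambda Y.[\![\Theta,\alpha\vdash\tau]\!](\rho,Y))\circledast(X\circledast\mathrm{next}\,\rho))$, so that $[\![\Theta\vdash\mu\alpha.\tau]\!](\rho)\equiv\triangleright([\![\Theta,\alpha\vdash\tau]\!](\rho,[\![\Theta\vdash\mu\alpha.\tau]\!](\rho)))$. -}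

module Defs where

open import Level using (Level; _⊔_; Setω)
open import Data.Nat using (ℕ; suc)
open import Data.Fin using (Fin; zero; suc)
open import Data.Unit using (⊤)
open import Data.Product using (_×_)
open import Data.Sum using (_⊎_)
open import Relation.Binary.PropositionalEquality using (_≡_)

-- An abstract model of the fragment of Guarded Dependent Type Theory
-- used in the paper (implicit clock).  The universe 𝒰 is Agda's Set
-- (codes and element types identified, à la Russell).  Judgemental
-- equalities of GDTT are rendered as propositional equalities.

record GDTT : Setω where
  infixl 4 _⊛_
  field
    ▹      : ∀ {ℓ} → Set ℓ → Set ℓ
    next   : ∀ {ℓ} {A : Set ℓ} → A → ▹ A
    _⊛_    : ∀ {ℓ ℓ'} {A : Set ℓ} {B : Set ℓ'} → ▹ (A → B) → ▹ A → ▹ B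
    next-⊛ : ∀ {ℓ ℓ'} {A : Set ℓ} {B : Set ℓ'} (f : A → B) (t : A) →
             (next f ⊛ next t) ≡ next (f t)
    fix    : ∀ {ℓ} {A : Set ℓ} → (▹ A → A) → A
    fix-eq : ∀ {ℓ} {A : Set ℓ} (f : ▹ A → A) → fix f ≡ f (next (fix f))
    -- code for later in the universe 𝒰 = Set
    ▹̂      : ▹ Set → Set
    ▹̂-next : (A : Set) → ▹̂ (next A) ≡ ▹ A
    -- ▹(t = u) ≡ (next t = next u), given as an equivalence of types
    ▹≡→    : ∀ {ℓ} {A : Set ℓ} {t u : A} → ▹ (t ≡ u) → next t ≡ next u
    ≡→▹    : ∀ {ℓ} {A : Set ℓ} {t u : A} → next t ≡ next u → ▹ (t ≡ u)

-- FPC types in a context of n type variables (de Bruijn; in a context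
-- Θ,β the variable β is zero, i.e. the most recently bound one).

infixr 6 _⇒_
infixr 7 _⊕_
infixr 8 _⊗_

data Ty (n : ℕ) : Set where
  var : Fin n → Ty n
  one : Ty n
  _⊗_ : Ty n → Ty n → Ty n
  _⊕_ : Ty n → Ty n → Ty n
  _⇒_ : Ty n → Ty n → Ty n
  μ   : Ty (suc n) → Ty n

ext : ∀ {n m} → (Fin n → Fin m) → Fin (suc n) → Fin (suc m)
ext r zero    = zero
ext r (suc i) = suc (r i)

rename : ∀ {n m} → (Fin n → Fin m) → Ty n → Ty m
rename r (var i) = var (r i)
rename r one     = one
rename r (a ⊗ b) = rename r a ⊗ rename r b
rename r (a ⊕ b) = rename r a ⊕ rename r b
rename r (a ⇒ b) = rename r a ⇒ rename r b
rename r (μ a)   = μ (rename (ext r) a)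

exts : ∀ {n m} → (Fin n → Ty m) → Fin (suc n) → Ty (suc m)
exts s zero    = var zero
exts s (suc i) = rename suc (s i)

subst : ∀ {n m} → (Fin n → Ty m) → Ty n → Ty m
subst s (var i) = s i
subst s one     = one
subst s (a ⊗ b) = subst s a ⊗ subst s b
subst s (a ⊕ b) = subst s a ⊕ subst s b
subst s (a ⇒ b) = subst s a ⇒ subst s b
subst s (μ a)   = μ (subst (exts s) a)

single : ∀ {n} → Ty n → Fin (suc n) → Ty n
single σ zero    = σ
single σ (suc i) = var i

_[_/β] : ∀ {n} → Ty (suc n) → Ty n → Ty n
τ [ σ /β] = subst (single σ) τ

Env : ℕ → Set₁
Env n = Fin n → Set

_,,_ : ∀ {n} → Env n → Set → Env (suc n)
(ρ ,, Y) zero    = Y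
(ρ ,, Y) (suc i) = ρ i

module Interp (G : GDTT) where
  open GDTT G

  L : Set → Set
  L A = fix (λ X → A ⊎ ▹̂ X)

  ⟦_⟧ : ∀ {n} → Ty n → Env n → Set
  ⟦ var i ⟧ ρ = ρ i
  ⟦ one   ⟧ ρ = L ⊤
  ⟦ a ⊗ b ⟧ ρ = ⟦ a ⟧ ρ × ⟦ b ⟧ ρ
  ⟦ a ⊕ b ⟧ ρ = L (⟦ a ⟧ ρ ⊎ ⟦ b ⟧ ρ)
  ⟦ a ⇒ b ⟧ ρ = ⟦ a ⟧ ρ → ⟦ b ⟧ ρ
  ⟦ μ a   ⟧   = fix (λ X ρ → ▹̂ (next (λ Y → ⟦ a ⟧ (ρ ,, Y)) ⊛ (X ⊛ next ρ)))

module Submission where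

-- The proof is the usual syntactic argument, strengthened to arbitrary
-- renamings and simultaneous substitutions so that it is closed under going
-- under a binder.  For μ the
-- interpretation is a guarded fixed point, so structural induction alone
-- does not suffice: we first record the one-step unfolding of ⟦ μ a ⟧, and
-- then prove by guarded recursion (fix, at the level of proofs) that two μ
-- types agree on related environments whenever their bodies do (μ-cong).

open import Defs
open import Data.Nat using (ℕ; suc)
open import Data.Fin using (Fin; zero; suc)
open import Data.Product using (_×_)
open import Data.Sum using (_⊎_)
open import Relation.Binary.PropositionalEquality
  using (_≡_; refl; sym; trans; cong; cong₂; cong-app; module ≡-Reasoning)

module Soundness (G : GDTT) where
  open GDTT G
  open Interp G

  unfold-μ : ∀ {n} (a : Ty (suc n)) (ρ : Env n) →
             ⟦ μ a ⟧ ρ ≡ ▹̂ (next (⟦ a ⟧ (ρ ,, ⟦ μ a ⟧ ρ)))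
  unfold-μ {n} a ρ = begin
      fix F ρ
    ≡⟨ cong-app (fix-eq F) ρ ⟩
      ▹̂ (next body ⊛ (next (fix F) ⊛ next ρ))
    ≡⟨ cong (λ x → ▹̂ (next body ⊛ x)) (next-⊛ (fix F) ρ) ⟩
      ▹̂ (next body ⊛ next (fix F ρ))
    ≡⟨ cong ▹̂ (next-⊛ body (fix F ρ)) ⟩
      ▹̂ (next (body (fix F ρ)))
    ∎
    where
    open ≡-Reasoning
    body : Set → Set
    body Y = ⟦ a ⟧ (ρ ,, Y)
    F : ▹ (Env n → Set) → Env n → Set
    F X η = ▹̂ (next (λ Y → ⟦ a ⟧ (η ,, Y)) ⊛ (X ⊛ next η))

  -- The hypothesis
  -- "⟦ μ a ⟧ ρ ≡ ⟦ μ b ⟧ ρ'" is only available later, which suffices since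
  -- the bodies occur under ▹̂ in the unfolding.
  μ-cong : ∀ {n m} (a : Ty (suc n)) (b : Ty (suc m)) (R : Env n → Env m → Set₁) →
           (∀ {ρ ρ' X X'} → R ρ ρ' → X ≡ X' → ⟦ a ⟧ (ρ ,, X) ≡ ⟦ b ⟧ (ρ' ,, X')) →
           ∀ {ρ ρ'} → R ρ ρ' → ⟦ μ a ⟧ ρ ≡ ⟦ μ b ⟧ ρ'
  μ-cong a b R bodies = fix λ later-μ-cong {ρ} {ρ'} r →
    let later-bodies : ▹ (⟦ a ⟧ (ρ ,, ⟦ μ a ⟧ ρ) ≡ ⟦ b ⟧ (ρ' ,, ⟦ μ b ⟧ ρ'))
        later-bodies = next (λ ih → bodies r (ih r)) ⊛ later-μ-cong
    in trans (unfold-μ a ρ) (trans (cong ▹̂ (▹≡→ later-bodies)) (sym (unfold-μ b ρ')))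

  Agrees : ∀ {n m} → (Fin n → Fin m) → Env m → Env n → Set₁
  Agrees r ρ ρ' = ∀ i → ρ (r i) ≡ ρ' i

  Agrees-ext : ∀ {n m} {r : Fin n → Fin m} {ρ ρ'} {X X' : Set} →
               Agrees r ρ ρ' → X ≡ X' → Agrees (ext r) (ρ ,, X) (ρ' ,, X')
  Agrees-ext r≈ X≡X' zero    = X≡X'
  Agrees-ext r≈ X≡X' (suc i) = r≈ i

  rename-sound : ∀ {n m} (r : Fin n → Fin m) (τ : Ty n) {ρ ρ'} →
                 Agrees r ρ ρ' → ⟦ rename r τ ⟧ ρ ≡ ⟦ τ ⟧ ρ'
  rename-sound r (var i) r≈ = r≈ i
  rename-sound r one     r≈ = refl
  rename-sound r (a ⊗ b) r≈ = cong₂ _×_ (rename-sound r a r≈) (rename-sound r b r≈)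
  rename-sound r (a ⊕ b) r≈ = cong L (cong₂ _⊎_ (rename-sound r a r≈) (rename-sound r b r≈))
  rename-sound r (a ⇒ b) r≈ = cong₂ (λ A B → A → B) (rename-sound r a r≈) (rename-sound r b r≈)
  rename-sound r (μ a)   r≈ = μ-cong (rename (ext r) a) a (Agrees r)
    (λ r≈ X≡X' → rename-sound (ext r) a (Agrees-ext r≈ X≡X')) r≈

  weaken-sound : ∀ {n} (τ : Ty n) (ρ : Env n) (X : Set) →
                 ⟦ rename suc τ ⟧ (ρ ,, X) ≡ ⟦ τ ⟧ ρ
  weaken-sound τ ρ X = rename-sound suc τ (λ _ → refl)

  Realises : ∀ {n m} → (Fin n → Ty m) → Env m → Env n → Set₁
  Realises s ρ ρ' = ∀ i → ⟦ s i ⟧ ρ ≡ ρ' i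

  Realises-exts : ∀ {n m} {s : Fin n → Ty m} {ρ ρ'} {X X' : Set} →
                  Realises s ρ ρ' → X ≡ X' → Realises (exts s) (ρ ,, X) (ρ' ,, X')
  Realises-exts         s≈ X≡X' zero    = X≡X'
  Realises-exts {s = s} s≈ X≡X' (suc i) = trans (weaken-sound (s i) _ _) (s≈ i)

  subst-sound : ∀ {n m} (s : Fin n → Ty m) (τ : Ty n) {ρ ρ'} →
                Realises s ρ ρ' → ⟦ subst s τ ⟧ ρ ≡ ⟦ τ ⟧ ρ'
  subst-sound s (var i) s≈ = s≈ i
  subst-sound s one     s≈ = refl
  subst-sound s (a ⊗ b) s≈ = cong₂ _×_ (subst-sound s a s≈) (subst-sound s b s≈)
  subst-sound s (a ⊕ b) s≈ = cong L (cong₂ _⊎_ (subst-sound s a s≈) (subst-sound s b s≈))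
  subst-sound s (a ⇒ b) s≈ = cong₂ (λ A B → A → B) (subst-sound s a s≈) (subst-sound s b s≈)
  subst-sound s (μ a)   s≈ = μ-cong (subst (exts s) a) a (Realises s)
    (λ s≈ X≡X' → subst-sound (exts s) a (Realises-exts s≈ X≡X')) s≈

  single-realised : ∀ {n} (σ : Ty n) (ρ : Env n) →
                    Realises (single σ) ρ (ρ ,, ⟦ σ ⟧ ρ)
  single-realised σ ρ zero    = refl
  single-realised σ ρ (suc i) = refl

lemma4p1 : (G : GDTT) → let open Interp G in
    ∀ {n : ℕ} (σ : Ty n) (τ : Ty (suc n)) (ρ : Env n) →
    ⟦ τ [ σ /β] ⟧ ρ ≡ ⟦ τ ⟧ (ρ ,, ⟦ σ ⟧ ρ)
lemma4p1 G σ τ ρ = subst-sound (single σ) τ (single-realised σ ρ)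
  where open Soundness G
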